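{- Let $\mathcal G$ be a hereditary graph class. The following are equivalent: (1) $\mathcal G$ has clique-bounded vertex cover number; (2) $\mathcal G$ has bounded $\alpha$-vertex cover number; (3) there exists a positive integer $n$ such that neither $nK_2$ nor $K_{n,n}$ belongs to $\mathcal G$.
   Context: All graphs are finite, simple and undirected; $\alpha,\omega$ denote independence and clique number. A hereditary graph class is a set of graphs closed under isomorphism and taking induced subgraphs. $nK_2$ is the disjoint union of $n$ edges; $K_{n,n}$ is the complete bipartite graph with parts of size $n$. $\mathrm{vc}(G)$ is the minimum size of a vertex cover (a vertex set meeting every edge) of $G$, and $\alpha\text{ - }\mathrm{vc}(G)$ is the minimum of $\alpha(G[S])$ over all vertex covers $S$ of $G$. $\mathcal G$ has clique-bounded $\mathrm{vc}$ if there is a nondecreasing $f$ with $\mathrm{vc}(G')\le f(\omega(G'))$ for every induced subgraph $G'$ of every $G\in\mathcal G$; it has bounded $\alpha\text{ - }\mathrm{vc}$ if there is an integer $k$ with $\alpha\text{ - }\mathrm{vc}(G')\le k$ for all such $G'$. -}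

module Defs where

open import Data.Nat using (ℕ; _≤_; _+_)
open import Data.Bool using (Bool; true; false)
open import Data.Fin using (Fin; splitAt)
open import Data.Fin.Properties using (_≟_)
open import Data.Fin.Subset using (Subset; _∈_; _⊆_; ∣_∣)
open import Data.Sum using (_⊎_; inj₁; inj₂)
open import Data.Product using (Σ; _×_; _,_)
open import Relation.Nullary using (¬_; ⌊_⌋)
open import Relation.Binary.PropositionalEquality using (_≡_; _≢_; refl)
open import Function.Definitions using (Injective)

record Graph : Set where
  field
    size    : ℕ
    adj     : Fin size → Fin size → Bool
    adj-sym : ∀ i j → adj i j ≡ adj j i
    adj-irr : ∀ i → adj i i ≡ false
open Graph public

-- H is (isomorphic to) an induced subgraph of G: an injective map
-- V(H) → V(G) preserving adjacency and non-adjacency.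
_≼_ : Graph → Graph → Set
H ≼ G = Σ (Fin (size H) → Fin (size G)) λ f →
          Injective _≡_ _≡_ f × (∀ i j → adj H i j ≡ adj G (f i) (f j))

GraphClass : Set₁
GraphClass = Graph → Set

Hereditary : GraphClass → Set
Hereditary 𝒢 = ∀ {G H} → H ≼ G → 𝒢 G → 𝒢 H

module _ (G : Graph) where

  IsClique : Subset (size G) → Set
  IsClique S = ∀ i j → i ∈ S → j ∈ S → i ≢ j → adj G i j ≡ true

  IsIndependent : Subset (size G) → Set
  IsIndependent S = ∀ i j → i ∈ S → j ∈ S → adj G i j ≡ false

  IsVertexCover : Subset (size G) → Set
  IsVertexCover S = ∀ i j → adj G i j ≡ true → i ∈ S ⊎ j ∈ S

  CliqueNumber : ℕ → Set
  CliqueNumber w = Σ (Subset (size G)) (λ S → IsClique S × ∣ S ∣ ≡ w)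
                 × (∀ S → IsClique S → ∣ S ∣ ≤ w)

  VCAtMost : ℕ → Set
  VCAtMost k = Σ (Subset (size G)) λ S → IsVertexCover S × ∣ S ∣ ≤ k

  -- α(G[S]) ≤ k   (independent sets of G[S] = independent sets of G inside S)
  αInAtMost : Subset (size G) → ℕ → Set
  αInAtMost S k = ∀ I → I ⊆ S → IsIndependent I → ∣ I ∣ ≤ k

  αVCAtMost : ℕ → Set
  αVCAtMost k = Σ (Subset (size G)) λ S → IsVertexCover S × αInAtMost S k

CliqueBoundedVC : GraphClass → Set
CliqueBoundedVC 𝒢 =
  Σ (ℕ → ℕ) λ f → (∀ a b → a ≤ b → f a ≤ f b) ×
    (∀ G H → 𝒢 G → H ≼ G → ∀ w → CliqueNumber H w → VCAtMost H (f w))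

BoundedαVC : GraphClass → Set
BoundedαVC 𝒢 = Σ ℕ λ k → ∀ G H → 𝒢 G → H ≼ G → αVCAtMost H k

bipAdj : ∀ n → (Fin n → Fin n → Bool) → Fin n ⊎ Fin n → Fin n ⊎ Fin n → Bool
bipAdj n r (inj₁ a) (inj₂ b) = r a b
bipAdj n r (inj₂ a) (inj₁ b) = r b a
bipAdj n r (inj₁ _) (inj₁ _) = false
bipAdj n r (inj₂ _) (inj₂ _) = false

bipAdj-sym : ∀ n r x y → bipAdj n r x y ≡ bipAdj n r y x
bipAdj-sym n r (inj₁ a) (inj₁ b) = refl
bipAdj-sym n r (inj₁ a) (inj₂ b) = refl
bipAdj-sym n r (inj₂ a) (inj₁ b) = refl
bipAdj-sym n r (inj₂ a) (inj₂ b) = refl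

bipAdj-irr : ∀ n r x → bipAdj n r x x ≡ false
bipAdj-irr n r (inj₁ a) = refl
bipAdj-irr n r (inj₂ a) = refl

bipGraph : ∀ n → (Fin n → Fin n → Bool) → Graph
bipGraph n r = record
  { size    = n + n
  ; adj     = λ i j → bipAdj n r (splitAt n i) (splitAt n j)
  ; adj-sym = λ i j → bipAdj-sym n r (splitAt n i) (splitAt n j)
  ; adj-irr = λ i → bipAdj-irr n r (splitAt n i)
  }

nK₂ : ℕ → Graph
nK₂ n = bipGraph n (λ a b → ⌊ a ≟ b ⌋)


Knn : ℕ → Graph
Knn n = bipGraph n (λ _ _ → true)

ExcludesMatchingAndBiclique : GraphClass → Set
ExcludesMatchingAndBiclique 𝒢 =
  Σ ℕ λ n → 1 ≤ n × ¬ 𝒢 (nK₂ n) × ¬ 𝒢 (Knn n)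

-- (1) ⇒ (2): the complement of a maximum independent set I is a vertex cover. An independent
-- set J outside I spans with I a bipartite, hence triangle-free, induced subgraph with a vertex
-- cover C of size at most f 2; as (I ∪ J) ∖ C is independent, |I| + |J| − |C| ≤ |I|.
-- (2) ⇒ (3): for n = k + 1, a vertex cover of nK₂ holds one end of every edge and a vertex
-- cover of K_{n,n} holds a whole side; either way it contains n independent vertices.
-- (3) ⇒ (1): the ends of a maximal matching M form a vertex cover of size 2|M|. If M is long,
-- Ramsey's theorem applied to the adjacencies between the ends of pairs of edges of M yields a
-- clique larger than ω, an induced nK₂, or an induced K_{n,n}.

module Submission where

open import Defs
open import Data.Bool using (Bool; true; false)
open import Data.Bool.Properties using (¬-not; T-≡) renaming (_≟_ to _≟ᵇ_)
open import Data.Empty using (⊥; ⊥-elim)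
open import Data.Fin using (Fin; zero; suc; toℕ; splitAt; join; _↑ˡ_; _↑ʳ_; inject≤; _<_)
open import Data.Fin.Properties
  using (suc-injective; injective⇒≤; pigeonhole; any?; all?; ¬∀⟶∃¬; <-cmp; <⇒≢; toℕ<n;
         splitAt-join; join-splitAt; ↑ˡ-injective; ↑ʳ-injective; toℕ-↑ˡ; toℕ-↑ʳ; toℕ-inject≤)
  renaming (_≟_ to _≟ᶠ_)
open import Data.Fin.Subset using (Subset; inside; outside; ⊤; ∁; _∈_; _⊆_; ∣_∣) renaming (⊥ to ∅)
open import Data.Fin.Subset.Properties
  using (_∈?_; anySubset?; ∉⊥; ∈⊤; ∣p∣≤n; ∣∁p∣≡n∸∣p∣; x∈∁p⇒x∉p; x∉p⇒x∈∁p)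
open import Data.List using (List; []; _∷_; length; lookup; foldl; cartesianProduct; allFin)
open import Data.List.Membership.Propositional using (lose) renaming (_∈_ to _∈ˡ_)
open import Data.List.Membership.Propositional.Properties using (∈-lookup; ∈-allFin; ∈-cartesianProduct⁺)
open import Data.List.Relation.Binary.Sublist.Propositional
  using ([]; _∷_; _∷ʳ_; minimum; ⊆-trans) renaming (_⊆_ to _⊑_)
open import Data.List.Relation.Binary.Sublist.Propositional.Properties using (All-resp-⊆)
open import Data.List.Relation.Unary.All as All using (All; []; _∷_)
open import Data.List.Relation.Unary.AllPairs as AllPairs using (AllPairs; []; _∷_)
open import Data.List.Relation.Unary.Any as Any using (Any; here; there; index)
open import Data.List.Relation.Unary.Any.Properties using (lookup-index)
open import Data.Nat as ℕ using (ℕ; zero; suc; _+_; _∸_; _≤_; _≟_; z≤n; s≤s)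
open import Data.Nat.Properties
  using (≤-refl; ≤-reflexive; ≤-trans; <⇒≤; ≰⇒>; ≮⇒≥; ≤-pred; ≤∧≢⇒<; <-≤-trans; 1+n≰n; _≤?_;
         m≤n⇒m<n∨m≡n; m≤m+n; m≤n+m; m≤n+m∸n; +-comm; +-suc; +-mono-≤; +-monoˡ-≤; +-monoʳ-≤;
         +-cancelˡ-≤; module ≤-Reasoning)
open import Data.Product using (Σ; ∃; ∃₂; _×_; _,_; proj₁; proj₂; swap)
open import Data.Sum as Sum using (_⊎_; inj₁; inj₂; [_,_]′)
open import Data.Vec using (_∷_; here; there; tabulate)
open import Data.Vec.Functional using (_++_)
open import Data.Vec.Functional.Properties using (lookup-++ˡ; lookup-++ʳ)
open import Data.Vec.Properties using (lookup∘tabulate; lookup⇒[]=; []=⇒lookup)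
open import Function using (_∘_; id)
open import Function.Bundles using (_⇔_; mk⇔; Equivalence)
open import Function.Definitions using (Injective)
open import Relation.Binary using (Symmetric; tri<; tri≈; tri>)
open import Relation.Binary.PropositionalEquality
  using (_≡_; _≢_; refl; sym; trans; cong; cong₂; subst; subst₂)
open import Relation.Nullary using (¬_; Dec; yes; no; does; ⌊_⌋; _×-dec_; _⊎-dec_; _→-dec_; ¬?)
open import Relation.Nullary.Decidable using (dec-true; toWitness; fromWitness)

private variable
  A : Set
  k m n N : ℕ

enumerate : (S : Subset m) → Fin ∣ S ∣ → Fin m
enumerate (inside ∷ S) zero = zero
enumerate (inside ∷ S) (suc i) = suc (enumerate S i)
enumerate (outside ∷ S) i = suc (enumerate S i)

enumerate-∈ : (S : Subset m) (i : Fin ∣ S ∣) → enumerate S i ∈ S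
enumerate-∈ (inside ∷ S) zero = here
enumerate-∈ (inside ∷ S) (suc i) = there (enumerate-∈ S i)
enumerate-∈ (outside ∷ S) i = there (enumerate-∈ S i)

enumerate-injective : (S : Subset m) → Injective _≡_ _≡_ (enumerate S)
enumerate-injective (inside ∷ S) {zero} {zero} _ = refl
enumerate-injective (inside ∷ S) {suc i} {suc j} eq = cong suc (enumerate-injective S (suc-injective eq))
enumerate-injective (outside ∷ S) eq = enumerate-injective S (suc-injective eq)

position : {S : Subset m} {x : Fin m} → x ∈ S → Fin ∣ S ∣
position {S = inside ∷ S} here = zero
position {S = inside ∷ S} (there x∈S) = suc (position x∈S)
position {S = outside ∷ S} (there x∈S) = position x∈S

enumerate-position : {S : Subset m} {x : Fin m} (x∈S : x ∈ S) → enumerate S (position x∈S) ≡ x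
enumerate-position {S = inside ∷ S} here = refl
enumerate-position {S = inside ∷ S} (there x∈S) = cong suc (enumerate-position x∈S)
enumerate-position {S = outside ∷ S} (there x∈S) = cong suc (enumerate-position x∈S)

injective⇒≤∣∣ : {u : Fin n → Fin m} (S : Subset m) → Injective _≡_ _≡_ u → (∀ i → u i ∈ S) →
  n ≤ ∣ S ∣
injective⇒≤∣∣ {u = u} S u-inj u∈S = injective⇒≤ λ {i} {j} eq →
  u-inj (trans (sym (enumerate-position (u∈S i))) (trans (cong (enumerate S) eq) (enumerate-position (u∈S j))))

image : (Fin n → Fin m) → Subset m
image u = tabulate λ x → does (any? λ i → u i ≟ᶠ x)

∈-image⁺ : (u : Fin n → Fin m) (i : Fin n) → u i ∈ image u
∈-image⁺ u i = lookup⇒[]= (u i) (image u)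
  (trans (lookup∘tabulate _ (u i)) (dec-true (any? λ j → u j ≟ᶠ u i) (i , refl)))

∈-image⁻ : (u : Fin n → Fin m) {x : Fin m} → x ∈ image u → ∃ λ i → u i ≡ x
∈-image⁻ u {x} x∈ with any? (λ i → u i ≟ᶠ x) | trans (sym (lookup∘tabulate _ x)) ([]=⇒lookup x∈)
... | yes found | _ = found
... | no _ | ()

∣image∣≤ : (u : Fin n → Fin m) → ∣ image u ∣ ≤ n
∣image∣≤ u = injective⇒≤ λ {i} {j} eq → enumerate-injective (image u)
  (trans (sym (proj₂ (preimage i))) (trans (cong u eq) (proj₂ (preimage j))))
  where
  preimage : ∀ i → ∃ λ k → u k ≡ enumerate (image u) i
  preimage i = ∈-image⁻ u (enumerate-∈ (image u) i)

image-⊆ : {u : Fin n → Fin m} {S : Subset m} → (∀ i → u i ∈ S) → image u ⊆ S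
image-⊆ {u = u} u∈S x∈ with ∈-image⁻ u x∈
... | i , refl = u∈S i

maximumSubset : (P : Subset m → Set) → (∀ S → Dec (P S)) → P ∅ →
  Σ (Subset m) λ S → P S × (∀ T → P T → ∣ T ∣ ≤ ∣ S ∣)
maximumSubset {m} P P? P∅ = search m (λ T _ → ∣p∣≤n T)
  where
  search : (b : ℕ) → (∀ T → P T → ∣ T ∣ ≤ b) →
    Σ (Subset m) λ S → P S × (∀ T → P T → ∣ T ∣ ≤ ∣ S ∣)
  search zero ≤0 = ∅ , P∅ , λ T PT → ≤-trans (≤0 T PT) z≤n
  search (suc b) ≤1+b with anySubset? (λ T → P? T ×-dec (∣ T ∣ ≟ suc b))
  ... | yes (S , PS , ∣S∣≡1+b) = S , PS , λ T PT → subst (∣ T ∣ ≤_) (sym ∣S∣≡1+b) (≤1+b T PT)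
  ... | no none = search b λ T PT → ≤-pred (≤∧≢⇒< (≤1+b T PT) λ eq → none (T , PT , eq))

distinct⇒injective : {f : Fin n → A} → (∀ {i j} → i ≢ j → f i ≢ f j) → Injective _≡_ _≡_ f
distinct⇒injective distinct {i} {j} eq with i ≟ᶠ j
... | yes i≡j = i≡j
... | no i≢j = ⊥-elim (distinct i≢j eq)

splitAt-injective : ∀ m n → Injective _≡_ _≡_ (splitAt m {n})
splitAt-injective m n {x} {y} eq = trans (sym (join-splitAt m n x)) (trans (cong (join m n) eq) (join-splitAt m n y))

join-injective : ∀ m n → Injective _≡_ _≡_ (join m n)
join-injective m n {x} {y} eq = trans (sym (splitAt-join m n x)) (trans (cong (splitAt m) eq) (splitAt-join m n y))

++-injective : {p q : ℕ} {f : Fin p → A} {g : Fin q → A} →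
  Injective _≡_ _≡_ f → Injective _≡_ _≡_ g → (∀ i j → f i ≢ g j) → Injective _≡_ _≡_ (f ++ g)
++-injective {p = p} {q} {f} {g} f-inj g-inj f≢g {x} {y} eq =
  splitAt-injective p q ([f,g]-injective (splitAt p x) (splitAt p y) eq)
  where
  [f,g]-injective : ∀ a b → [ f , g ]′ a ≡ [ f , g ]′ b → a ≡ b
  [f,g]-injective (inj₁ i) (inj₁ j) e = cong inj₁ (f-inj e)
  [f,g]-injective (inj₁ i) (inj₂ j) e = ⊥-elim (f≢g i j e)
  [f,g]-injective (inj₂ i) (inj₁ j) e = ⊥-elim (f≢g j i (sym e))
  [f,g]-injective (inj₂ i) (inj₂ j) e = cong inj₂ (g-inj e)

Ordered : (A → A → Set) → (Fin N → A) → Set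
Ordered R E = ∀ {i j} → i < j → R (E i) (E j)

lookup-ordered : {R : A → A → Set} {xs : List A} → AllPairs R xs → Ordered R (lookup xs)
lookup-ordered {xs = x ∷ xs} (Rx ∷ _) {zero} {suc j} _ = All.lookup Rx (∈-lookup j)
lookup-ordered {xs = x ∷ xs} (_ ∷ Rxs) {suc i} {suc j} (s≤s i<j) = lookup-ordered Rxs i<j

ordered⇒pairwise : {R : A → A → Set} {E : Fin N → A} → Symmetric R → Ordered R E →
  ∀ {i j} → i ≢ j → R (E i) (E j)
ordered⇒pairwise R-sym E-ordered {i} {j} i≢j with <-cmp i j
... | tri< i<j _ _ = E-ordered i<j
... | tri≈ _ i≡j _ = ⊥-elim (i≢j i≡j)
... | tri> _ _ j<i = R-sym (E-ordered j<i)

inject≤-mono : ∀ {i j : Fin n} (n≤N : n ≤ N) → i < j → inject≤ i n≤N < inject≤ j n≤N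
inject≤-mono {i = i} {j} n≤N = subst₂ ℕ._<_ (sym (toℕ-inject≤ i n≤N)) (sym (toℕ-inject≤ j n≤N))

↑ˡ<↑ʳ : ∀ (i j : Fin n) → i ↑ˡ n < n ↑ʳ j
↑ˡ<↑ʳ {n} i j = subst₂ ℕ._<_ (sym (toℕ-↑ˡ i n)) (sym (toℕ-↑ʳ n j))
  (<-≤-trans (toℕ<n i) (m≤m+n n (toℕ j)))

-- Ramsey's theorem for lists

AllPairs-resp-⊑ : {R : A → A → Set} {xs ys : List A} → xs ⊑ ys → AllPairs R ys → AllPairs R xs
AllPairs-resp-⊑ [] [] = []
AllPairs-resp-⊑ (y ∷ʳ xs⊑ys) (_ ∷ Rys) = AllPairs-resp-⊑ xs⊑ys Rys
AllPairs-resp-⊑ (refl ∷ xs⊑ys) (Rx ∷ Rys) = All-resp-⊆ xs⊑ys Rx ∷ AllPairs-resp-⊑ xs⊑ys Rys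

ramseyBound : ℕ → ℕ → ℕ
ramseyBound zero t = 0
ramseyBound (suc s) zero = 0
ramseyBound (suc s) (suc t) = suc (ramseyBound s (suc t) + ramseyBound (suc s) t)

module _ {A : Set} (c : A → A → Bool) where

  Monochromatic : Bool → List A → Set
  Monochromatic β = AllPairs λ x y → c x y ≡ β

  partitionBy : (x : A) (xs : List A) → Σ (List A) λ rs → Σ (List A) λ bs →
    rs ⊑ xs × bs ⊑ xs × All (λ y → c x y ≡ true) rs × All (λ y → c x y ≡ false) bs ×
    length rs + length bs ≡ length xs
  partitionBy x [] = [] , [] , [] , [] , [] , [] , refl
  partitionBy x (y ∷ xs) with partitionBy x xs | c x y in cxy
  ... | rs , bs , rs⊑ , bs⊑ , rs-red , bs-blue , len | true =
    y ∷ rs , bs , refl ∷ rs⊑ , y ∷ʳ bs⊑ , cxy ∷ rs-red , bs-blue , cong suc len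
  ... | rs , bs , rs⊑ , bs⊑ , rs-red , bs-blue , len | false =
    rs , y ∷ bs , y ∷ʳ rs⊑ , refl ∷ bs⊑ , rs-red , cxy ∷ bs-blue ,
    trans (+-suc (length rs) (length bs)) (cong suc len)

  ramsey : ∀ s t (xs : List A) → ramseyBound s t ≤ length xs → ∃ λ ys → ys ⊑ xs ×
    (s ≤ length ys × Monochromatic true ys ⊎ t ≤ length ys × Monochromatic false ys)
  ramsey zero t xs _ = [] , minimum xs , inj₁ (z≤n , [])
  ramsey (suc s) zero xs _ = [] , minimum xs , inj₂ (z≤n , [])
  ramsey (suc s) (suc t) (x ∷ xs) (s≤s bound≤) with partitionBy x xs
  ... | rs , bs , rs⊑ , bs⊑ , rs-red , bs-blue , len with ramseyBound s (suc t) ≤? length rs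
  ... | yes many-red with ramsey s (suc t) rs many-red
  ...   | ys , ys⊑ , inj₁ (s≤ , mono) =
    x ∷ ys , refl ∷ ⊆-trans ys⊑ rs⊑ , inj₁ (s≤s s≤ , All-resp-⊆ ys⊑ rs-red ∷ mono)
  ...   | ys , ys⊑ , inj₂ (t≤ , mono) = ys , x ∷ʳ ⊆-trans ys⊑ rs⊑ , inj₂ (t≤ , mono)
  ramsey (suc s) (suc t) (x ∷ xs) (s≤s bound≤) | rs , bs , rs⊑ , bs⊑ , rs-red , bs-blue , len | no few-red
    with ramsey (suc s) t bs many-blue
    where
    many-blue : ramseyBound (suc s) t ≤ length bs
    many-blue = +-cancelˡ-≤ (length rs) _ _ (≤-trans (+-monoˡ-≤ _ (<⇒≤ (≰⇒> few-red)))
                  (≤-trans bound≤ (≤-reflexive (sym len))))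
  ...   | ys , ys⊑ , inj₁ (s≤ , mono) = ys , x ∷ʳ ⊆-trans ys⊑ bs⊑ , inj₁ (s≤ , mono)
  ...   | ys , ys⊑ , inj₂ (t≤ , mono) =
    x ∷ ys , refl ∷ ⊆-trans ys⊑ bs⊑ , inj₂ (s≤s t≤ , All-resp-⊆ ys⊑ bs-blue ∷ mono)

  ramsey-diagonal : ∀ s (xs : List A) → ramseyBound s s ≤ length xs →
    ∃₂ λ β ys → ys ⊑ xs × s ≤ length ys × Monochromatic β ys
  ramsey-diagonal s xs bound≤ with ramsey s s xs bound≤
  ... | ys , ys⊑ , inj₁ (s≤ , mono) = true , ys , ys⊑ , s≤ , mono
  ... | ys , ys⊑ , inj₂ (s≤ , mono) = false , ys , ys⊑ , s≤ , mono

≼-refl : (G : Graph) → G ≼ G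
≼-refl G = id , id , λ _ _ → refl

≼-trans : {F G H : Graph} → F ≼ G → G ≼ H → F ≼ H
≼-trans (f , f-inj , f-adj) (g , g-inj , g-adj) =
  g ∘ f , f-inj ∘ g-inj , λ i j → trans (f-adj i j) (g-adj (f i) (f j))

induced : (G : Graph) → (Fin n → Fin (size G)) → Graph
induced G u = record
  { size = _
  ; adj = λ i j → adj G (u i) (u j)
  ; adj-sym = λ i j → adj-sym G (u i) (u j)
  ; adj-irr = λ i → adj-irr G (u i)
  }

induced-≼ : (G : Graph) {u : Fin n → Fin (size G)} → Injective _≡_ _≡_ u → induced G u ≼ G
induced-≼ G {u} u-inj = u , u-inj , λ _ _ → refl

true≢false : ∀ {b} → b ≡ true → b ≢ false
true≢false refl ()

module _ (G : Graph) where

  private V = Fin (size G)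

  IsIndependentFamily : (Fin n → V) → Set
  IsIndependentFamily u = ∀ i j → adj G (u i) (u j) ≡ false

  IsCliqueFamily : (Fin n → V) → Set
  IsCliqueFamily u = ∀ i j → i ≢ j → adj G (u i) (u j) ≡ true

  enumerate-independent : {S : Subset (size G)} → IsIndependent G S → IsIndependentFamily (enumerate S)
  enumerate-independent {S} S-ind i j = S-ind _ _ (enumerate-∈ S i) (enumerate-∈ S j)

  image-independent : {u : Fin n → V} → IsIndependentFamily u → IsIndependent G (image u)
  image-independent {u = u} u-ind x y x∈ y∈ with ∈-image⁻ u x∈ | ∈-image⁻ u y∈
  ... | i , refl | j , refl = u-ind i j

  image-clique : {u : Fin n → V} → IsCliqueFamily u → IsClique G (image u)
  image-clique {u = u} u-clique x y x∈ y∈ x≢y with ∈-image⁻ u x∈ | ∈-image⁻ u y∈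
  ... | i , refl | j , refl = u-clique i j (x≢y ∘ cong u)

  independentFamily-≤ : {S : Subset (size G)} → αInAtMost G S k → {u : Fin n → V} →
    Injective _≡_ _≡_ u → (∀ i → u i ∈ S) → IsIndependentFamily u → n ≤ k
  independentFamily-≤ α≤k {u} u-inj u∈S u-ind =
    ≤-trans (injective⇒≤∣∣ (image u) u-inj (∈-image⁺ u))
            (α≤k (image u) (image-⊆ u∈S) (image-independent u-ind))

  cliqueFamily-≤ : (∀ S → IsClique G S → ∣ S ∣ ≤ k) → {u : Fin n → V} →
    Injective _≡_ _≡_ u → IsCliqueFamily u → n ≤ k
  cliqueFamily-≤ ω≤k {u} u-inj u-clique =
    ≤-trans (injective⇒≤∣∣ (image u) u-inj (∈-image⁺ u)) (ω≤k (image u) (image-clique u-clique))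

  isClique? : ∀ S → Dec (IsClique G S)
  isClique? S = all? λ i → all? λ j →
    i ∈? S →-dec (j ∈? S →-dec (¬? (i ≟ᶠ j) →-dec (adj G i j ≟ᵇ true)))

  isIndependent? : ∀ S → Dec (IsIndependent G S)
  isIndependent? S = all? λ i → all? λ j → i ∈? S →-dec (j ∈? S →-dec (adj G i j ≟ᵇ false))

  cliqueNumber : Σ ℕ (CliqueNumber G)
  cliqueNumber =
    let S , S-clique , S-max = maximumSubset (IsClique G) isClique? (λ i _ i∈⊥ → ⊥-elim (∉⊥ i∈⊥))
    in ∣ S ∣ , (S , S-clique , refl) , S-max

  maximumIndependentSet : Σ (Subset (size G)) λ I → IsIndependent G I × αInAtMost G ⊤ ∣ I ∣
  maximumIndependentSet =
    let I , I-ind , I-max =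
          maximumSubset (IsIndependent G) isIndependent? (λ i _ i∈⊥ → ⊥-elim (∉⊥ i∈⊥))
    in I , I-ind , λ J _ J-ind → I-max J J-ind

  clique-≤-colours : (c : Fin (size G) → Fin k) → (∀ x y → adj G x y ≡ true → c x ≢ c y) →
    ∀ S → IsClique G S → ∣ S ∣ ≤ k
  clique-≤-colours c proper S S-clique = ≮⇒≥ λ k<∣S∣ →
    let i , j , i<j , same = pigeonhole k<∣S∣ (c ∘ enumerate S)
    in proper _ _ (S-clique _ _ (enumerate-∈ S i) (enumerate-∈ S j) (<⇒≢ i<j ∘ enumerate-injective S)) same

  ∁-independent⇒vertexCover : {I : Subset (size G)} → IsIndependent G I → IsVertexCover G (∁ I)
  ∁-independent⇒vertexCover {I} I-ind i j i~j with i ∈? I | j ∈? I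
  ... | no i∉I | _ = inj₁ (x∉p⇒x∈∁p i∉I)
  ... | yes _ | no j∉I = inj₂ (x∉p⇒x∈∁p j∉I)
  ... | yes i∈I | yes j∈I = ⊥-elim (true≢false i~j (I-ind i j i∈I j∈I))

  ∁-vertexCover⇒independent : {C : Subset (size G)} → IsVertexCover G C → IsIndependent G (∁ C)
  ∁-vertexCover⇒independent C-cover i j i∈ j∈ =
    ¬-not λ i~j → [ x∈∁p⇒x∉p i∈ , x∈∁p⇒x∉p j∈ ]′ (C-cover i j i~j)

  bipGraph-≼ : (r : Fin n → Fin n → Bool) {L R : Fin n → Fin (size G)} →
    Injective _≡_ _≡_ L → Injective _≡_ _≡_ R → (∀ i j → L i ≢ R j) →
    IsIndependentFamily L → IsIndependentFamily R → (∀ i j → adj G (L i) (R j) ≡ r i j) →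
    bipGraph n r ≼ G
  bipGraph-≼ {n} r {L} {R} L-inj R-inj L≢R L-ind R-ind L~R =
    L ++ R , ++-injective L-inj R-inj L≢R , λ x y → adj-[L,R] (splitAt n x) (splitAt n y)
    where
    adj-[L,R] : ∀ a b → bipAdj n r a b ≡ adj G ([ L , R ]′ a) ([ L , R ]′ b)
    adj-[L,R] (inj₁ i) (inj₁ j) = sym (L-ind i j)
    adj-[L,R] (inj₁ i) (inj₂ j) = sym (L~R i j)
    adj-[L,R] (inj₂ i) (inj₁ j) = trans (sym (L~R j i)) (adj-sym G (L j) (R i))
    adj-[L,R] (inj₂ i) (inj₂ j) = sym (R-ind i j)

-- Clique-bounded vertex cover implies bounded α-vertex cover

m+n∸o≤m⇒n≤o : ∀ m n o → m + n ∸ o ≤ m → n ≤ o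
m+n∸o≤m⇒n≤o m n o m+n∸o≤m = +-cancelˡ-≤ m n o (begin
  m + n           ≤⟨ m≤n+m∸n (m + n) o ⟩
  o + (m + n ∸ o) ≤⟨ +-monoʳ-≤ o m+n∸o≤m ⟩
  o + m           ≡⟨ +-comm o m ⟩
  m + o           ∎)
  where open ≤-Reasoning

module _ (G : Graph) {p q : ℕ} {f : Fin p → Fin (size G)} {g : Fin q → Fin (size G)} where

  ++-clique≤2 : IsIndependentFamily G f → IsIndependentFamily G g →
    ∀ S → IsClique (induced G (f ++ g)) S → ∣ S ∣ ≤ 2
  ++-clique≤2 f-ind g-ind = clique-≤-colours (induced G (f ++ g)) side proper
    where
    side : Fin (p + q) → Fin 2
    side x = [ (λ _ → zero) , (λ _ → suc zero) ]′ (splitAt p x)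
    proper : ∀ x y → adj G ((f ++ g) x) ((f ++ g) y) ≡ true → side x ≢ side y
    proper x y with splitAt p x | splitAt p y
    ... | inj₁ i | inj₁ j = λ i~j _ → true≢false i~j (f-ind i j)
    ... | inj₁ _ | inj₂ _ = λ _ ()
    ... | inj₂ _ | inj₁ _ = λ _ ()
    ... | inj₂ i | inj₂ j = λ i~j _ → true≢false i~j (g-ind i j)

InducedTriangleFreeVCAtMost : Graph → ℕ → Set
InducedTriangleFreeVCAtMost H b = ∀ {p} (u : Fin p → Fin (size H)) → Injective _≡_ _≡_ u →
  (∀ S → IsClique (induced H u) S → ∣ S ∣ ≤ 2) → VCAtMost (induced H u) b

αInAtMost-∁maximum : (H : Graph) {b : ℕ} {I : Subset (size H)} →
  IsIndependent H I → αInAtMost H ⊤ ∣ I ∣ → InducedTriangleFreeVCAtMost H b → αInAtMost H (∁ I) b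
αInAtMost-∁maximum H {b} {I} I-ind α≤∣I∣ triangleFree-vc J J⊆∁I J-ind =
  let C , C-cover , ∣C∣≤b = triangleFree-vc u u-inj
        (++-clique≤2 H (enumerate-independent H I-ind) (enumerate-independent H J-ind))
      ∣∁C∣≤∣I∣ = independentFamily-≤ H α≤∣I∣ (enumerate-injective (∁ C) ∘ u-inj) (λ _ → ∈⊤)
        (enumerate-independent (induced H u) (∁-vertexCover⇒independent (induced H u) C-cover))
  in ≤-trans (m+n∸o≤m⇒n≤o (∣ I ∣) (∣ J ∣) (∣ C ∣) (subst (_≤ ∣ I ∣) (∣∁p∣≡n∸∣p∣ C) ∣∁C∣≤∣I∣))
             ∣C∣≤b
  where
  u = enumerate I ++ enumerate J
  u-inj : Injective _≡_ _≡_ u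
  u-inj = ++-injective (enumerate-injective I) (enumerate-injective J) λ i j eq →
    x∈∁p⇒x∉p (J⊆∁I (enumerate-∈ J j)) (subst (_∈ I) eq (enumerate-∈ I i))

inducedTriangleFreeVC⇒αVC : (H : Graph) {b : ℕ} → InducedTriangleFreeVCAtMost H b → αVCAtMost H b
inducedTriangleFreeVC⇒αVC H triangleFree-vc =
  let I , I-ind , α≤∣I∣ = maximumIndependentSet H
  in ∁ I , ∁-independent⇒vertexCover H I-ind , αInAtMost-∁maximum H I-ind α≤∣I∣ triangleFree-vc

cliqueBoundedVC⇒boundedαVC : (𝒢 : GraphClass) → CliqueBoundedVC 𝒢 → BoundedαVC 𝒢
cliqueBoundedVC⇒boundedαVC 𝒢 (f , f-mono , f-vc) = f 2 , λ G H G∈𝒢 H≼G →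
  inducedTriangleFreeVC⇒αVC H λ u u-inj ω≤2 →
    let w , ω≡w = cliqueNumber (induced H u)
        S , S-clique , ∣S∣≡w = proj₁ ω≡w
        u≼G = ≼-trans {induced H u} {H} {G} (induced-≼ H u-inj) H≼G
        C , C-cover , ∣C∣≤fw = f-vc G (induced H u) G∈𝒢 u≼G w ω≡w
    in C , C-cover , ≤-trans ∣C∣≤fw (f-mono w 2 (subst (_≤ 2) ∣S∣≡w (ω≤2 S S-clique)))

-- Bounded α-vertex cover excludes nK₂ and K_{n,n}

module _ {n : ℕ} (r : Fin n → Fin n → Bool) where

  bipGraph-adj : ∀ x y → adj (bipGraph n r) (join n n x) (join n n y) ≡ bipAdj n r x y
  bipGraph-adj x y = cong₂ (bipAdj n r) (splitAt-join n n x) (splitAt-join n n y)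

  bipGraph-left-independent : IsIndependentFamily (bipGraph n r) (_↑ˡ n)
  bipGraph-left-independent i j = bipGraph-adj (inj₁ i) (inj₁ j)

  bipGraph-right-independent : IsIndependentFamily (bipGraph n r) (n ↑ʳ_)
  bipGraph-right-independent i j = bipGraph-adj (inj₂ i) (inj₂ j)

αVCAtMost-Knn : αVCAtMost (Knn n) k → n ≤ k
αVCAtMost-Knn {n} (S , S-cover , α≤k) with all? (λ i → (i ↑ˡ n) ∈? S)
... | yes left⊆S =
  independentFamily-≤ (Knn n) α≤k (↑ˡ-injective n _ _) left⊆S (bipGraph-left-independent _)
... | no left⊈S with ¬∀⟶∃¬ n _ (λ i → (i ↑ˡ n) ∈? S) left⊈S
...   | i₀ , i₀∉S =
  independentFamily-≤ (Knn n) α≤k (↑ʳ-injective n _ _) right⊆S (bipGraph-right-independent _)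
  where
  right⊆S : ∀ j → (n ↑ʳ j) ∈ S
  right⊆S j = [ ⊥-elim ∘ i₀∉S , id ]′ (S-cover _ _ (bipGraph-adj _ (inj₁ i₀) (inj₂ j)))

nK₂-edge : ∀ i → adj (nK₂ n) (i ↑ˡ n) (n ↑ʳ i) ≡ true
nK₂-edge i = trans (bipGraph-adj _ (inj₁ i) (inj₂ i))
  (Equivalence.to T-≡ (fromWitness {a? = i ≟ᶠ i} refl))

nK₂-adj⇒sameIndex : ∀ x y → bipAdj n (λ a b → ⌊ a ≟ᶠ b ⌋) x y ≡ true →
  [ id , id ]′ x ≡ [ id , id ]′ y
nK₂-adj⇒sameIndex (inj₁ a) (inj₂ b) a~b = toWitness (Equivalence.from T-≡ a~b)
nK₂-adj⇒sameIndex (inj₂ a) (inj₁ b) b~a = sym (toWitness (Equivalence.from T-≡ b~a))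

αVCAtMost-nK₂ : αVCAtMost (nK₂ n) k → n ≤ k
αVCAtMost-nK₂ {n} (S , S-cover , α≤k) = independentFamily-≤ (nK₂ n) α≤k
  (distinct⇒injective λ i≢j → i≢j ∘ pick-injective ∘ join-injective n n)
  u∈S
  λ i j → trans (bipGraph-adj _ (pick i) (pick j)) (pick-independent i j)
  where
  r = λ (a b : Fin n) → ⌊ a ≟ᶠ b ⌋
  pick : Fin n → Fin n ⊎ Fin n
  pick i with (i ↑ˡ n) ∈? S
  ... | yes _ = inj₁ i
  ... | no _ = inj₂ i
  index-pick : ∀ i → [ id , id ]′ (pick i) ≡ i
  index-pick i with (i ↑ˡ n) ∈? S
  ... | yes _ = refl
  ... | no _ = refl
  pick-injective : ∀ {i j} → pick i ≡ pick j → i ≡ j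
  pick-injective {i} {j} eq = trans (sym (index-pick i)) (trans (cong [ id , id ]′ eq) (index-pick j))
  u∈S : ∀ i → join n n (pick i) ∈ S
  u∈S i with (i ↑ˡ n) ∈? S
  ... | yes i∈S = i∈S
  ... | no i∉S = [ ⊥-elim ∘ i∉S , id ]′ (S-cover _ _ (nK₂-edge i))
  pick-independent : ∀ i j → bipAdj n r (pick i) (pick j) ≡ false
  pick-independent i j with i ≟ᶠ j
  ... | yes refl = bipAdj-irr n r (pick i)
  ... | no i≢j = ¬-not λ i~j →
    i≢j (trans (sym (index-pick i)) (trans (nK₂-adj⇒sameIndex (pick i) (pick j) i~j) (index-pick j)))

boundedαVC⇒excludes : (𝒢 : GraphClass) → BoundedαVC 𝒢 → ExcludesMatchingAndBiclique 𝒢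
boundedαVC⇒excludes 𝒢 (k , αvc≤k) =
  suc k , s≤s z≤n , 1+n≰n ∘ αVCAtMost-nK₂ ∘ αvc≤k-self , 1+n≰n ∘ αVCAtMost-Knn ∘ αvc≤k-self
  where
  αvc≤k-self : ∀ {G} → 𝒢 G → αVCAtMost G k
  αvc≤k-self {G} G∈𝒢 = αvc≤k G G G∈𝒢 (≼-refl G)

-- Maximal matchings

module _ (H : Graph) where

  private V = Fin (size H)

  Edge : Set
  Edge = V × V

  _∈ₑ_ : V → Edge → Set
  x ∈ₑ e = x ≡ proj₁ e ⊎ x ≡ proj₂ e

  IsEdge : Edge → Set
  IsEdge e = adj H (proj₁ e) (proj₂ e) ≡ true

  Disjoint : Edge → Edge → Set
  Disjoint e e′ = ∀ {x} → x ∈ₑ e → x ∈ₑ e′ → ⊥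

  IsMatching : List Edge → Set
  IsMatching M = All IsEdge M × AllPairs Disjoint M

  Covered : List Edge → V → Set
  Covered M x = Any (x ∈ₑ_) M

  covered? : ∀ M x → Dec (Covered M x)
  covered? M x = Any.any? (λ e → (x ≟ᶠ proj₁ e) ⊎-dec (x ≟ᶠ proj₂ e)) M

  Addable : List Edge → Edge → Set
  Addable M e = IsEdge e × ¬ Covered M (proj₁ e) × ¬ Covered M (proj₂ e)

  addable? : ∀ M e → Dec (Addable M e)
  addable? M e =
    (adj H (proj₁ e) (proj₂ e) ≟ᵇ true) ×-dec ¬? (covered? M (proj₁ e)) ×-dec ¬? (covered? M (proj₂ e))

  extend : List Edge → Edge → List Edge
  extend M e with addable? M e
  ... | yes _ = e ∷ M
  ... | no _ = M

  extend-isMatching : ∀ {M} e → IsMatching M → IsMatching (extend M e)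
  extend-isMatching {M} e (edges , disjoint) with addable? M e
  ... | yes (edge , ¬cov₁ , ¬cov₂) = edge ∷ edges , All.tabulate e-disjoint ∷ disjoint
    where
    e-disjoint : ∀ {e′} → e′ ∈ˡ M → Disjoint e e′
    e-disjoint e′∈M (inj₁ refl) x∈e′ = ¬cov₁ (lose e′∈M x∈e′)
    e-disjoint e′∈M (inj₂ refl) x∈e′ = ¬cov₂ (lose e′∈M x∈e′)
  ... | no _ = edges , disjoint

  extend-covered : ∀ {M x} e → Covered M x → Covered (extend M e) x
  extend-covered {M} e x-cov with addable? M e
  ... | yes _ = there x-cov
  ... | no _ = x-cov

  extend-covers : ∀ M e → IsEdge e → Covered (extend M e) (proj₁ e) ⊎ Covered (extend M e) (proj₂ e)
  extend-covers M e edge with addable? M e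
  ... | yes _ = inj₁ (here (inj₁ refl))
  ... | no not-addable with covered? M (proj₁ e) | covered? M (proj₂ e)
  ...   | yes cov₁ | _ = inj₁ cov₁
  ...   | no _ | yes cov₂ = inj₂ cov₂
  ...   | no ¬cov₁ | no ¬cov₂ = ⊥-elim (not-addable (edge , ¬cov₁ , ¬cov₂))

  greedy-isMatching : ∀ M es → IsMatching M → IsMatching (foldl extend M es)
  greedy-isMatching M [] M-matching = M-matching
  greedy-isMatching M (e ∷ es) M-matching = greedy-isMatching (extend M e) es (extend-isMatching e M-matching)

  greedy-covered : ∀ {x} M es → Covered M x → Covered (foldl extend M es) x
  greedy-covered M [] x-cov = x-cov
  greedy-covered M (e ∷ es) x-cov = greedy-covered (extend M e) es (extend-covered e x-cov)

  greedy-covers : ∀ M es {e} → e ∈ˡ es → IsEdge e →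
    Covered (foldl extend M es) (proj₁ e) ⊎ Covered (foldl extend M es) (proj₂ e)
  greedy-covers M (e ∷ es) (here refl) edge with extend-covers M e edge
  ... | inj₁ cov₁ = inj₁ (greedy-covered (extend M e) es cov₁)
  ... | inj₂ cov₂ = inj₂ (greedy-covered (extend M e) es cov₂)
  greedy-covers M (e′ ∷ es) (there e∈es) edge = greedy-covers (extend M e′) es e∈es edge

  endpoints : (M : List Edge) → Fin (length M + length M) → V
  endpoints M = (proj₁ ∘ lookup M) ++ (proj₂ ∘ lookup M)

  covered⇒∈endpoints : ∀ {M x} → Covered M x → x ∈ image (endpoints M)
  covered⇒∈endpoints {M} x-cov with lookup-index x-cov
  ... | inj₁ x≡ = subst (_∈ image (endpoints M))
    (trans (lookup-++ˡ (proj₁ ∘ lookup M) (proj₂ ∘ lookup M) (index x-cov)) (sym x≡))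
    (∈-image⁺ (endpoints M) (index x-cov ↑ˡ length M))
  ... | inj₂ x≡ = subst (_∈ image (endpoints M))
    (trans (lookup-++ʳ (proj₁ ∘ lookup M) (proj₂ ∘ lookup M) (index x-cov)) (sym x≡))
    (∈-image⁺ (endpoints M) (length M ↑ʳ index x-cov))

  maximalMatching : Σ (List Edge) λ M → IsMatching M × VCAtMost H (length M + length M)
  maximalMatching =
    M , greedy-isMatching [] allPairs ([] , []) , image (endpoints M) , cover , ∣image∣≤ (endpoints M)
    where
    allPairs = cartesianProduct (allFin (size H)) (allFin (size H))
    M = foldl extend [] allPairs
    cover : IsVertexCover H (image (endpoints M))
    cover i j i~j with greedy-covers [] allPairs (∈-cartesianProduct⁺ (∈-allFin i) (∈-allFin j)) i~j
    ... | inj₁ cov₁ = inj₁ (covered⇒∈endpoints cov₁)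
    ... | inj₂ cov₂ = inj₂ (covered⇒∈endpoints cov₂)

-- Long matchings contain a large clique, an induced nK₂ or an induced K_{n,n}

module _ (H : Graph) where

  private V = Fin (size H)

  endAdj : (Edge H → V) → (Edge H → V) → Edge H → Edge H → Bool
  endAdj p q e e′ = adj H (p e) (q e′)

  Separated : Edge H → Edge H → Set
  Separated e e′ =
    Disjoint H e e′ × endAdj proj₁ proj₁ e e′ ≡ false × endAdj proj₂ proj₂ e e′ ≡ false

  Separated-sym : Symmetric Separated
  Separated-sym (disjoint , a≁a , b≁b) =
    (λ x∈e′ x∈e → disjoint x∈e x∈e′) , trans (adj-sym H _ _) a≁a , trans (adj-sym H _ _) b≁b

  Pattern : Bool → Bool → Edge H → Edge H → Set
  Pattern β₃ β₄ e e′ =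
    Separated e e′ × endAdj proj₁ proj₂ e e′ ≡ β₃ × endAdj proj₂ proj₁ e e′ ≡ β₄

  Pattern-swap : ∀ {β₃ β₄ e e′} → Pattern β₃ β₄ e e′ → Pattern β₄ β₃ (swap e) (swap e′)
  Pattern-swap ((disjoint , a≁a , b≁b) , a~b , b~a) =
    ((λ x∈e x∈e′ → disjoint (Sum.swap x∈e) (Sum.swap x∈e′)) , b≁b , a≁a) , b~a , a~b

  separatedFamily-≼ : ∀ {N n} {E : Fin N → Edge H} → (∀ k → IsEdge H (E k)) →
    (∀ {k l} → k ≢ l → Separated (E k) (E l)) →
    (r : Fin n → Fin n → Bool) {ι κ : Fin n → Fin N} → Injective _≡_ _≡_ ι → Injective _≡_ _≡_ κ →
    (∀ i j → adj H (proj₁ (E (ι i))) (proj₂ (E (κ j))) ≡ r i j) → bipGraph n r ≼ H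
  separatedFamily-≼ {N} {n} {E} edge separated r {ι} {κ} ι-inj κ-inj ι~κ = bipGraph-≼ H r
    (distinct⇒injective λ i≢j eq → proj₁ (separated (i≢j ∘ ι-inj)) (inj₁ refl) (inj₁ eq))
    (distinct⇒injective λ i≢j eq → proj₁ (separated (i≢j ∘ κ-inj)) (inj₂ refl) (inj₂ eq))
    ends-distinct
    (independent proj₁ (proj₁ ∘ proj₂) ι-inj)
    (independent proj₂ (proj₂ ∘ proj₂) κ-inj)
    ι~κ
    where
    ends-distinct : ∀ i j → proj₁ (E (ι i)) ≢ proj₂ (E (κ j))
    ends-distinct i j eq with ι i ≟ᶠ κ j
    ... | no ιi≢κj = proj₁ (separated ιi≢κj) (inj₁ refl) (inj₂ eq)
    ... | yes ιi≡κj = true≢false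
      (subst (λ x → adj H x (proj₂ (E (ι i))) ≡ true) (trans eq (cong (proj₂ ∘ E) (sym ιi≡κj)))
        (edge (ι i)))
      (adj-irr H _)
    independent : (p : Edge H → V) → (∀ {e e′} → Separated e e′ → adj H (p e) (p e′) ≡ false) →
      {σ : Fin n → Fin N} → Injective _≡_ _≡_ σ → IsIndependentFamily H (p ∘ E ∘ σ)
    independent p p-separated σ-inj i j with i ≟ᶠ j
    ... | yes refl = adj-irr H _
    ... | no i≢j = p-separated (separated (i≢j ∘ σ-inj))

  monochromaticEnds-≤ : ∀ {w} → (∀ S → IsClique H S → ∣ S ∣ ≤ w) →
    (p : Edge H → V) → (∀ {e e′} → Disjoint H e e′ → p e ≢ p e′) →
    ∀ {ys} → AllPairs (Disjoint H) ys → Monochromatic (endAdj p p) true ys → length ys ≤ w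
  monochromaticEnds-≤ ω≤w p p-distinct {ys} disjoint mono = cliqueFamily-≤ H ω≤w
    (distinct⇒injective (proj₁ ∘ pairwise)) (λ i j → proj₂ ∘ pairwise {i} {j})
    where
    DistinctAdjacent : Edge H → Edge H → Set
    DistinctAdjacent e e′ = p e ≢ p e′ × adj H (p e) (p e′) ≡ true
    pairwise : ∀ {i j} → i ≢ j → DistinctAdjacent (lookup ys i) (lookup ys j)
    pairwise = ordered⇒pairwise {R = DistinctAdjacent} (λ (≢ , ~) → ≢ ∘ sym , trans (adj-sym H _ _) ~)
      (lookup-ordered (AllPairs.zip (AllPairs.map p-distinct disjoint , mono)))

module _ (H : Graph) {n : ℕ} (nK₂⋠H : ¬ nK₂ n ≼ H) (Knn⋠H : ¬ Knn n ≼ H) where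

  private
    separated : ∀ {β₃ β₄ N} {E : Fin N → Edge H} → Ordered (Pattern H β₃ β₄) E →
      ∀ {k l} → k ≢ l → Separated H (E k) (E l)
    separated ordered = ordered⇒pairwise {R = Separated H} (Separated-sym H) (proj₁ ∘ ordered)

    crossAdj : ∀ {β N} {E : Fin N → Edge H} → Ordered (Pattern H β β) E →
      ∀ {k l} → k ≢ l → adj H (proj₁ (E k)) (proj₂ (E l)) ≡ β
    crossAdj ordered {k} {l} k≢l with <-cmp k l
    ... | tri< k<l _ _ = proj₁ (proj₂ (ordered k<l))
    ... | tri≈ _ k≡l _ = ⊥-elim (k≢l k≡l)
    ... | tri> _ _ l<k = trans (adj-sym H _ _) (proj₂ (proj₂ (ordered l<k)))

  -- Here aᵢbⱼ is an edge exactly when i ≤ j, so the first n a-ends and the last n b-ends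
  -- span a K_{n,n}.
  halfPattern⇒⊥ : {E : Fin (n + n) → Edge H} → (∀ k → IsEdge H (E k)) →
    Ordered (Pattern H true false) E → ⊥
  halfPattern⇒⊥ edge ordered = Knn⋠H (separatedFamily-≼ H edge (separated ordered) _
    (↑ˡ-injective n _ _) (↑ʳ-injective n _ _) λ i j → proj₁ (proj₂ (ordered (↑ˡ<↑ʳ i j))))

  pattern⇒⊥ : ∀ β₃ β₄ {E : Fin (n + n) → Edge H} → (∀ k → IsEdge H (E k)) →
    Ordered (Pattern H β₃ β₄) E → ⊥
  pattern⇒⊥ false false {E} edge ordered = nK₂⋠H (separatedFamily-≼ H edge (separated ordered) _
    (↑ˡ-injective n _ _) (↑ˡ-injective n _ _) ends-adj)
    where
    ends-adj : ∀ i j → adj H (proj₁ (E (i ↑ˡ n))) (proj₂ (E (j ↑ˡ n))) ≡ ⌊ i ≟ᶠ j ⌋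
    ends-adj i j with i ≟ᶠ j
    ... | yes refl = edge (i ↑ˡ n)
    ... | no i≢j = crossAdj ordered (i≢j ∘ ↑ˡ-injective n i j)
  pattern⇒⊥ true true {E} edge ordered = Knn⋠H (separatedFamily-≼ H edge (separated ordered) _
    (↑ˡ-injective n _ _) (↑ˡ-injective n _ _) ends-adj)
    where
    ends-adj : ∀ i j → adj H (proj₁ (E (i ↑ˡ n))) (proj₂ (E (j ↑ˡ n))) ≡ true
    ends-adj i j with i ≟ᶠ j
    ... | yes refl = edge (i ↑ˡ n)
    ... | no i≢j = crossAdj ordered (i≢j ∘ ↑ˡ-injective n i j)
  pattern⇒⊥ true false edge ordered = halfPattern⇒⊥ edge ordered
  pattern⇒⊥ false true {E} edge ordered =
    halfPattern⇒⊥ {swap ∘ E} (λ k → trans (adj-sym H (proj₂ (E k)) (proj₁ (E k))) (edge k))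
      (Pattern-swap H ∘ ordered)

  patternList⇒⊥ : ∀ β₃ β₄ {vs} → All (IsEdge H) vs → AllPairs (Pattern H β₃ β₄) vs →
    n + n ≤ length vs → ⊥
  patternList⇒⊥ β₃ β₄ {vs} edges vs-pattern 2n≤ = pattern⇒⊥ β₃ β₄
    (λ k → All.lookup edges (∈-lookup (inject≤ k 2n≤)))
    (lookup-ordered vs-pattern ∘ inject≤-mono 2n≤)

-- Ramsey's theorem is applied four times, colouring a pair of edges ab before a′b′ by the
-- adjacency of aa′, of bb′, of ab′ and of ba′; an edge colour in the first two rounds
-- yields a clique of size w + 1.
matchingBound : ℕ → ℕ → ℕ
matchingBound n w = ramseyBound (suc w) (ramseyBound (suc w) (ramseyBound T T))
  where T = ramseyBound (n + n) (n + n)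

module _ (H : Graph) {n w : ℕ} (nK₂⋠H : ¬ nK₂ n ≼ H) (Knn⋠H : ¬ Knn n ≼ H)
         (ω≤w : ∀ S → IsClique H S → ∣ S ∣ ≤ w) where

  large-matching⇒⊥ : ∀ M → IsMatching H M → matchingBound n w ≤ length M → ⊥
  large-matching⇒⊥ M (edges , disjoint) large
    with ramsey (endAdj H proj₁ proj₁) (suc w) _ M large
  ... | ys , ys⊑M , inj₁ (w<ys , ys-mono) =
    1+n≰n (≤-trans w<ys (monochromaticEnds-≤ H ω≤w proj₁ (λ D eq → D (inj₁ refl) (inj₁ eq))
                          (AllPairs-resp-⊑ ys⊑M disjoint) ys-mono))
  ... | ys , ys⊑M , inj₂ (ys-large , ys-mono₁)
    with ramsey (endAdj H proj₂ proj₂) (suc w) _ ys ys-large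
  ... | zs , zs⊑ys , inj₁ (w<zs , zs-mono) =
    1+n≰n (≤-trans w<zs (monochromaticEnds-≤ H ω≤w proj₂ (λ D eq → D (inj₂ refl) (inj₂ eq))
                          (AllPairs-resp-⊑ (⊆-trans zs⊑ys ys⊑M) disjoint) zs-mono))
  ... | zs , zs⊑ys , inj₂ (zs-large , zs-mono₂)
    with ramsey-diagonal (endAdj H proj₁ proj₂) _ zs zs-large
  ... | β₃ , us , us⊑zs , us-large , us-mono₃
    with ramsey-diagonal (endAdj H proj₂ proj₁) (n + n) us us-large
  ... | β₄ , vs , vs⊑us , vs-large , vs-mono₄ =
    patternList⇒⊥ H {n} nK₂⋠H Knn⋠H β₃ β₄ (All-resp-⊆ vs⊑M edges) vs-pattern vs-large
    where
    vs⊑zs = ⊆-trans vs⊑us us⊑zs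
    vs⊑ys = ⊆-trans vs⊑zs zs⊑ys
    vs⊑M = ⊆-trans vs⊑ys ys⊑M
    vs-separated = AllPairs.zip (AllPairs-resp-⊑ vs⊑M disjoint ,
                                 AllPairs.zip (AllPairs-resp-⊑ vs⊑ys ys-mono₁ , AllPairs-resp-⊑ vs⊑zs zs-mono₂))
    vs-pattern = AllPairs.zip (vs-separated , AllPairs.zip (AllPairs-resp-⊑ vs⊑us us-mono₃ , vs-mono₄))

-- A nondecreasing majorant, as required of the bound in CliqueBoundedVC.
prefixSum : (ℕ → ℕ) → ℕ → ℕ
prefixSum g zero = g zero
prefixSum g (suc w) = g (suc w) + prefixSum g w

≤-prefixSum : ∀ g w → g w ≤ prefixSum g w
≤-prefixSum g zero = ≤-refl
≤-prefixSum g (suc w) = m≤m+n (g (suc w)) (prefixSum g w)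

prefixSum-mono : ∀ g a b → a ≤ b → prefixSum g a ≤ prefixSum g b
prefixSum-mono g a zero z≤n = ≤-refl
prefixSum-mono g a (suc b) a≤1+b with m≤n⇒m<n∨m≡n a≤1+b
... | inj₁ (s≤s a≤b) = ≤-trans (prefixSum-mono g a b a≤b) (m≤n+m (prefixSum g b) (g (suc b)))
... | inj₂ refl = ≤-refl

excludes⇒cliqueBoundedVC : (𝒢 : GraphClass) → Hereditary 𝒢 → ExcludesMatchingAndBiclique 𝒢 →
  CliqueBoundedVC 𝒢
excludes⇒cliqueBoundedVC 𝒢 hereditary (n , _ , nK₂∉𝒢 , Knn∉𝒢) =
  prefixSum twiceBound , prefixSum-mono twiceBound , λ G H G∈𝒢 H≼G w (_ , ω≤w) →
    let H∈𝒢 = hereditary {G} {H} H≼G G∈𝒢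
        M , M-matching , C , C-cover , ∣C∣≤2∣M∣ = maximalMatching H
        ∣M∣≤ = <⇒≤ (≰⇒> (large-matching⇒⊥ H {n} (excluded nK₂∉𝒢 H∈𝒢) (excluded Knn∉𝒢 H∈𝒢) ω≤w
                                           M M-matching))
    in C , C-cover , ≤-trans ∣C∣≤2∣M∣ (≤-trans (+-mono-≤ ∣M∣≤ ∣M∣≤) (≤-prefixSum twiceBound w))
  where
  excluded : ∀ {F H} → ¬ 𝒢 F → 𝒢 H → ¬ F ≼ H
  excluded {F} {H} F∉𝒢 H∈𝒢 F≼H = F∉𝒢 (hereditary {H} {F} F≼H H∈𝒢)
  twiceBound : ℕ → ℕ
  twiceBound w = matchingBound n w + matchingBound n w

theorem5p28 : (𝒢 : GraphClass) → Hereditary 𝒢 →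
    (CliqueBoundedVC 𝒢 ⇔ BoundedαVC 𝒢) × (BoundedαVC 𝒢 ⇔ ExcludesMatchingAndBiclique 𝒢)
theorem5p28 𝒢 hereditary =
  mk⇔ (cliqueBoundedVC⇒boundedαVC 𝒢) (excludes⇒cliqueBoundedVC 𝒢 hereditary ∘ boundedαVC⇒excludes 𝒢) ,
  mk⇔ (boundedαVC⇒excludes 𝒢) (cliqueBoundedVC⇒boundedαVC 𝒢 ∘ excludes⇒cliqueBoundedVC 𝒢 hereditary)
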